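{- Let $G$ be a finite complemented group with chief series $G=N_1\rhd\dots\rhd N_{k+1}=1$, let $\mathcal B=\{B_1,\dots,B_k\}$ be a base-set, and let $x\in G$ be such that $B_i\neq B_ix$ for all $i$. Then the meet-subsemilattice of $\mathfrak{C}(G)$ generated by $\mathcal B\cup\mathcal Bx$ (closing under intersection) is isomorphic to the face lattice of the boundary of a $k$-cube.
   Context: $G$ complemented: every subgroup $H$ has $K$ with $HK=G$, $H\cap K=1$. $\mathfrak{C}(G)$: right cosets of proper subgroups together with $\emptyset$ and $G$, ordered by inclusion, with meet $=$ intersection. A base-set is $\mathcal B=\{B_i:1\le i\le k\}$ with each $B_i$ a complement to $N_i/N_{i+1}$ ($N_iB_i=G$, $N_i\cap B_i=N_{i+1}$); $\mathcal Bx=\{B_ix\}$. -}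

module Defs where

open import Level using (Level; _⊔_)
open import Algebra.Bundles using (Group)
open import Data.Product using (Σ; ∃; _×_; _,_)
open import Data.Sum using (_⊎_)
open import Data.Bool using (Bool; true; false)
open import Data.Fin using (Fin; zero; suc; inject₁; fromℕ)
open import Data.Nat using (ℕ; suc)
open import Data.Maybe using (Maybe; just; nothing)
open import Data.List using (List; _∷_)
open import Data.List.Relation.Unary.All using (All)
open import Data.List.Relation.Unary.Any using (Any)
open import Relation.Nullary using (¬_)
open import Relation.Binary.PropositionalEquality using (_≡_; _≢_)
open import Relation.Binary using (Decidable)
open import Function.Bundles using (_⇔_)

-- A nonempty proper face is a word in {lo, hi, star}^k that is not all
-- star (coordinate fixed to 0, fixed to 1, or free); 'nothing' is the
-- empty face.

data Sym : Set where
  lo hi star : Sym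

CubeBoundaryFace : ℕ → Set
CubeBoundaryFace k = Maybe (Σ (Fin k → Sym) λ w → ∃ λ i → w i ≢ star)

_⊑ˢ_ : Sym → Sym → Set
s ⊑ˢ s' = (s' ≡ star) ⊎ (s ≡ s')

_≤F_ : ∀ {k} → CubeBoundaryFace k → CubeBoundaryFace k → Set
nothing ≤F _ = Data.Unit.⊤ where import Data.Unit
just _ ≤F nothing = Data.Empty.⊥ where import Data.Empty
just (w , _) ≤F just (w' , _) = ∀ i → w i ⊑ˢ w' i

module _ {c ℓ : Level} (G : Group c ℓ) where
  open Group G

  SubsetG : Set (Level.suc (c ⊔ ℓ))
  SubsetG = Carrier → Set (c ⊔ ℓ)

  _⊆G_ : SubsetG → SubsetG → Set (c ⊔ ℓ)
  S ⊆G T = ∀ y → S y → T y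

  _≐G_ : SubsetG → SubsetG → Set (c ⊔ ℓ)
  S ≐G T = (S ⊆G T) × (T ⊆G S)

  IsFinite : Set (c ⊔ ℓ)
  IsFinite = Decidable _≈_ × Σ (List Carrier) λ xs → ∀ x → Any (x ≈_) xs

  record Subgroup : Set (Level.suc (c ⊔ ℓ)) where
    field
      mem      : SubsetG
      resp     : ∀ {x y} → x ≈ y → mem x → mem y
      ε-mem    : mem ε
      ∙-mem    : ∀ {x y} → mem x → mem y → mem (x ∙ y)
      ⁻¹-mem   : ∀ {x} → mem x → mem (x ⁻¹)
  open Subgroup public

  IsNormal : Subgroup → Set (c ⊔ ℓ)
  IsNormal N = ∀ g n → mem N n → mem N ((g ∙ n) ∙ g ⁻¹)

  ProductIsWhole : Subgroup → Subgroup → Set (c ⊔ ℓ)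
  ProductIsWhole H K = ∀ g → Σ Carrier λ h → Σ Carrier λ k →
    mem H h × mem K k × (g ≈ h ∙ k)

  IsComplemented : Set (Level.suc (c ⊔ ℓ))
  IsComplemented = (H : Subgroup) → Σ Subgroup λ K →
    ProductIsWhole H K × (∀ g → mem H g → mem K g → g ≈ ε)

  WholeSet : SubsetG
  WholeSet _ = Level.Lift (c ⊔ ℓ) Data.Unit.⊤ where import Data.Unit

  TrivialSet : SubsetG
  TrivialSet g = Level.Lift c (g ≈ ε)

  -- chief series G = N₀ ▷ N₁ ▷ ... ▷ N_k = 1  (0-based indices;
  -- the paper's N_{i+1} is our N i)
  IsChiefSeries : (k : ℕ) → (Fin (suc k) → Subgroup) → Set (Level.suc (c ⊔ ℓ))
  IsChiefSeries k N =
    (mem (N zero) ≐G WholeSet) ×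
    (mem (N (fromℕ k)) ≐G TrivialSet) ×
    (∀ i → IsNormal (N i)) ×
    (∀ (i : Fin k) → mem (N (suc i)) ⊆G mem (N (inject₁ i))) ×
    (∀ (i : Fin k) → ¬ (mem (N (inject₁ i)) ⊆G mem (N (suc i)))) ×
    (∀ (i : Fin k) (M : Subgroup) → IsNormal M →
       mem (N (suc i)) ⊆G mem M → mem M ⊆G mem (N (inject₁ i)) →
       (mem M ≐G mem (N (suc i))) ⊎ (mem M ≐G mem (N (inject₁ i))))

  IsBaseSet : (k : ℕ) → (Fin (suc k) → Subgroup) → (Fin k → Subgroup) → Set (c ⊔ ℓ)
  IsBaseSet k N B = ∀ (i : Fin k) →
    ProductIsWhole (N (inject₁ i)) (B i) ×
    ((λ g → mem (N (inject₁ i)) g × mem (B i) g) ≐G mem (N (suc i)))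

  RightCoset : Subgroup → Carrier → SubsetG
  RightCoset H x y = Σ Carrier λ h → mem H h × (y ≈ h ∙ x)

  Gen : {k : ℕ} → (Fin k → Subgroup) → Carrier → Fin k × Bool → SubsetG
  Gen B x (i , false) = mem (B i)
  Gen B x (i , true)  = RightCoset (B i) x

  InterGen : {k : ℕ} → (Fin k → Subgroup) → Carrier →
             Fin k × Bool → List (Fin k × Bool) → SubsetG
  InterGen B x j js y = All (λ j' → Gen B x j' y) (j ∷ js)

  InGenerated : {k : ℕ} → (Fin k → Subgroup) → Carrier → SubsetG → Set (c ⊔ ℓ)
  InGenerated {k} B x S = Σ (Fin k × Bool) λ j → Σ (List (Fin k × Bool)) λ js →
    S ≐G InterGen B x j js

-- A word w ∈ {lo, hi, star}^k names the set ⋂ᵢ Sᵢ with Sᵢ = Bᵢ, Bᵢx or G. Since the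
-- base-set condition makes every family of cosets Bᵢtᵢ meet (a Chinese remainder
-- argument down the chief series), these sets are all nonempty, and inclusion between
-- them is read off coordinatewise: if Sᵢ ⊋ Sᵢ′ then refining the i-th coordinate of w to
-- the coset disjoint from Sᵢ′ gives a point of the first set outside the second. Hence
-- words are faces of the cube, and since Bᵢ ∩ Bᵢx = ∅ (x ∉ Bᵢ) every intersection of
-- generators is either such a face or empty. The all-star word (the interior of the
-- cube) never arises, since an intersection of generators lies in some Bᵢ or Bᵢx.
module Submission where

open import Defs
open import Level using (Level; lift)
open import Algebra.Bundles using (Group)
import Algebra.Properties.Group as GroupProperties
open import Data.Nat using (ℕ; suc; _≥_)
open import Data.Fin using (Fin; zero; suc; inject₁; _≟_)
open import Data.Product using (Σ; _×_; _,_; proj₁; proj₂)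
open import Data.Sum using (_⊎_; inj₁; inj₂)
open import Data.Bool using (Bool; true; false)
open import Data.Maybe using (just; nothing)
open import Data.List using (List; []; _∷_; concat; tabulate)
open import Data.List.Relation.Unary.All using (All; []; _∷_)
import Data.List.Relation.Unary.All as All
open import Data.List.Relation.Unary.All.Properties using (concat⁺; concat⁻; tabulate⁺; tabulate⁻)
open import Data.Vec.Functional using (updateAt)
open import Data.Vec.Functional.Properties using (updateAt-updates; updateAt-minimal)
open import Data.Empty using (⊥-elim)
open import Data.Unit using (tt)
open import Function using (const)
open import Relation.Nullary using (¬_; yes; no)
open import Relation.Binary.PropositionalEquality using (_≢_; refl; sym; subst)
open import Function.Bundles using (_⇔_; mk⇔)

≐G-sym : ∀ {c ℓ} (G : Group c ℓ) {S T : SubsetG G} → _≐G_ G S T → _≐G_ G T S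
≐G-sym G (S⊆T , T⊆S) = T⊆S , S⊆T

module Cosets {c ℓ : Level} (G : Group c ℓ) where
  open Group G hiding (refl) renaming (sym to ≈-sym)
  open GroupProperties G using (\\-leftDividesʳ; //-rightDividesˡ)
  open import Relation.Binary.Reasoning.Setoid setoid

  RightCoset-resp : ∀ H {t y z} → y ≈ z → RightCoset G H t y → RightCoset G H t z
  RightCoset-resp H y≈z (h , h∈H , y≈ht) = h , h∈H , trans (≈-sym y≈z) y≈ht

  RightCoset-∙ˡ : ∀ H {t h y} → mem H h → RightCoset G H t y → RightCoset G H t (h ∙ y)
  RightCoset-∙ˡ H {t} {h} h∈H (h′ , h′∈H , y≈h′t) =
    h ∙ h′ , ∙-mem H h∈H h′∈H , trans (∙-congˡ y≈h′t) (≈-sym (assoc h h′ t))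

  RightCoset-ε : ∀ H {y} → RightCoset G H ε y → mem H y
  RightCoset-ε H (h , h∈H , y≈hε) = resp H (≈-sym (trans y≈hε (identityʳ h))) h∈H

  ∈⇒≐RightCoset : ∀ H {x} → mem H x → _≐G_ G (mem H) (RightCoset G H x)
  ∈⇒≐RightCoset H {x} x∈H =
    (λ y y∈H → y ∙ x ⁻¹ , ∙-mem H y∈H (⁻¹-mem H x∈H) , ≈-sym (//-rightDividesˡ x y)) ,
    (λ { y (h , h∈H , y≈hx) → resp H (≈-sym y≈hx) (∙-mem H h∈H x∈H) })

  ∉⇒RightCoset-disjoint : ∀ H {x} → ¬ mem H x → ∀ y → mem H y → ¬ RightCoset G H x y
  ∉⇒RightCoset-disjoint H {x} x∉H y y∈H (h , h∈H , y≈hx) =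
    x∉H (resp H (trans (∙-congˡ y≈hx) (\\-leftDividesʳ h x)) (∙-mem H (⁻¹-mem H h∈H) y∈H))

  factor⇒RightCoset : ∀ H {g t m b} → mem H b → g ∙ t ⁻¹ ≈ m ∙ b → RightCoset G H t (m ⁻¹ ∙ g)
  factor⇒RightCoset H {g} {t} {m} {b} b∈H g∙t⁻¹≈m∙b = b , b∈H , (begin
    m ⁻¹ ∙ g              ≈⟨ ∙-congˡ (//-rightDividesˡ t g) ⟨
    m ⁻¹ ∙ (g ∙ t ⁻¹ ∙ t)  ≈⟨ ∙-congˡ (∙-congʳ g∙t⁻¹≈m∙b) ⟩
    m ⁻¹ ∙ (m ∙ b ∙ t)     ≈⟨ ∙-congˡ (assoc m b t) ⟩
    m ⁻¹ ∙ (m ∙ (b ∙ t))   ≈⟨ \\-leftDividesʳ m (b ∙ t) ⟩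
    b ∙ t                  ∎)

  -- Write g t₀⁻¹ = m b with m ∈ N₀, b ∈ B₀; then m⁻¹g ∈ B₀t₀, and the correction n coming
  -- from the shorter series lies in N₁ ⊆ B₀, so it does not move m⁻¹g out of B₀t₀.
  N₀-coset-meets-cosets : ∀ {k} (N : Fin (suc k) → Subgroup G) (B : Fin k → Subgroup G) →
    (∀ i → _⊆G_ G (mem (N (suc i))) (mem (N (inject₁ i)))) →
    (∀ i → _⊆G_ G (mem (N (suc i))) (mem (B i))) →
    (∀ i → ProductIsWhole G (N (inject₁ i)) (B i)) →
    ∀ g (t : Fin k → Carrier) →
    Σ Carrier λ n → mem (N zero) n × (∀ i → RightCoset G (B i) (t i) (n ∙ g))
  N₀-coset-meets-cosets {ℕ.zero} N B _ _ _ g t = ε , ε-mem (N zero) , λ ()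
  N₀-coset-meets-cosets {suc k} N B N-descending N⊆B NB≡G g t
    with NB≡G zero (g ∙ t zero ⁻¹)
  ... | m , b , m∈N₀ , b∈B₀ , g∙t₀⁻¹≈m∙b
    with N₀-coset-meets-cosets (λ i → N (suc i)) (λ i → B (suc i))
           (λ i → N-descending (suc i)) (λ i → N⊆B (suc i)) (λ i → NB≡G (suc i))
           (m ⁻¹ ∙ g) (λ i → t (suc i))
  ... | n , n∈N₁ , n∙m⁻¹g∈cosets =
    n ∙ m ⁻¹ , ∙-mem (N zero) (N-descending zero n n∈N₁) (⁻¹-mem (N zero) m∈N₀) , in-coset
    where
      in-coset : ∀ i → RightCoset G (B i) (t i) (n ∙ m ⁻¹ ∙ g)
      in-coset zero = RightCoset-resp (B zero) (≈-sym (assoc n (m ⁻¹) g))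
        (RightCoset-∙ˡ (B zero) (N⊆B zero n n∈N₁) (factor⇒RightCoset (B zero) b∈B₀ g∙t₀⁻¹≈m∙b))
      in-coset (suc i) = RightCoset-resp (B (suc i)) (≈-sym (assoc n (m ⁻¹) g)) (n∙m⁻¹g∈cosets i)

module CubeFaces {c ℓ : Level} (G : Group c ℓ) {k : ℕ} (B : Fin k → Subgroup G) (x : Group.Carrier G)
  (cosets-meet : ∀ (t : Fin k → Group.Carrier G) →
                 Σ (Group.Carrier G) λ g → ∀ i → RightCoset G (B i) (t i) g)
  (x∉B : ∀ i → ¬ mem (B i) x) where
  open Group G using (Carrier; ε)
  open Cosets G using (RightCoset-ε; ∉⇒RightCoset-disjoint)

  SymSet : Sym → Fin k → SubsetG G
  SymSet lo   i = mem (B i)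
  SymSet hi   i = RightCoset G (B i) x
  SymSet star i = WholeSet G

  FaceSet : (Fin k → Sym) → SubsetG G
  FaceSet w y = ∀ i → SymSet (w i) i y

  SymSet-mono : ∀ {s t} i → s ⊑ˢ t → _⊆G_ G (SymSet s i) (SymSet t i)
  SymSet-mono i (inj₁ refl) y _ = lift tt
  SymSet-mono i (inj₂ refl) y p = p

  lo-hi-disjoint : ∀ i y → SymSet lo i y → ¬ SymSet hi i y
  lo-hi-disjoint i = ∉⇒RightCoset-disjoint (B i) (x∉B i)

  representative : Sym → Carrier
  representative lo   = ε
  representative hi   = x
  representative star = ε

  RightCoset-representative⊆SymSet : ∀ s i →
    _⊆G_ G (RightCoset G (B i) (representative s)) (SymSet s i)
  RightCoset-representative⊆SymSet lo   i y = RightCoset-ε (B i)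
  RightCoset-representative⊆SymSet hi   i y p = p
  RightCoset-representative⊆SymSet star i y _ = lift tt

  FaceSet-nonempty : ∀ w → Σ Carrier (FaceSet w)
  FaceSet-nonempty w with cosets-meet (λ i → representative (w i))
  ... | g , g∈cosets = g , λ i → RightCoset-representative⊆SymSet (w i) i g (g∈cosets i)

  FaceSet-updateAt : ∀ w i {s} → s ⊑ˢ w i →
    _≐G_ G (FaceSet (updateAt w i (const s))) (λ y → SymSet s i y × FaceSet w y)
  FaceSet-updateAt w i {s} s⊑wᵢ = (λ y c → at-i y (c i) , λ j → restrict y j (c j)) ,
                                  (λ { y (p , c) j → extend y j p (c j) })
    where
      at-i : ∀ y → SymSet (updateAt w i (const s) i) i y → SymSet s i y
      at-i y = subst (λ u → SymSet u i y) (updateAt-updates i w)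

      restrict : ∀ y j → SymSet (updateAt w i (const s) j) j y → SymSet (w j) j y
      restrict y j p with j ≟ i
      ... | yes refl = SymSet-mono i s⊑wᵢ y (at-i y p)
      ... | no j≢i   = subst (λ u → SymSet u j y) (updateAt-minimal j i w j≢i) p

      extend : ∀ y j → SymSet s i y → SymSet (w j) j y → SymSet (updateAt w i (const s) j) j y
      extend y j p q with j ≟ i
      ... | yes refl = subst (λ u → SymSet u i y) (sym (updateAt-updates i w)) p
      ... | no j≢i   = subst (λ u → SymSet u j y) (sym (updateAt-minimal j i w j≢i)) q

  -- The face refined at coordinate i to o is still nonempty, but it misses S.
  FaceSet⊈ : ∀ w i {o} → o ⊑ˢ w i → (S : SubsetG G) →
    (∀ y → SymSet o i y → ¬ S y) → ¬ _⊆G_ G (FaceSet w) S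
  FaceSet⊈ w i {o} o⊑wᵢ S o∩S≡∅ w⊆S with FaceSet-nonempty (updateAt w i (const o))
  ... | y , c with proj₁ (FaceSet-updateAt w i o⊑wᵢ) y c
  ...   | p , c′ = o∩S≡∅ y p (w⊆S y c′)

  FaceSet⊆SymSet⇒⊑ : ∀ w i s → _⊆G_ G (FaceSet w) (SymSet s i) → w i ⊑ˢ s
  FaceSet⊆SymSet⇒⊑ w i star _ = inj₁ refl
  FaceSet⊆SymSet⇒⊑ w i lo w⊆lo with w i in e
  ... | lo   = inj₂ refl
  ... | hi   = ⊥-elim (FaceSet⊈ w i (inj₂ (sym e)) (SymSet lo i) (λ y q p → lo-hi-disjoint i y p q) w⊆lo)
  ... | star = ⊥-elim (FaceSet⊈ w i {hi} (inj₁ e) (SymSet lo i) (λ y q p → lo-hi-disjoint i y p q) w⊆lo)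
  FaceSet⊆SymSet⇒⊑ w i hi w⊆hi with w i in e
  ... | hi   = inj₂ refl
  ... | lo   = ⊥-elim (FaceSet⊈ w i (inj₂ (sym e)) (SymSet hi i) (lo-hi-disjoint i) w⊆hi)
  ... | star = ⊥-elim (FaceSet⊈ w i {lo} (inj₁ e) (SymSet hi i) (lo-hi-disjoint i) w⊆hi)

  FaceSet-⊆⇔⊑ : ∀ w w′ → (∀ i → w i ⊑ˢ w′ i) ⇔ _⊆G_ G (FaceSet w) (FaceSet w′)
  FaceSet-⊆⇔⊑ w w′ = mk⇔ (λ w⊑w′ y c i → SymSet-mono i (w⊑w′ i) y (c i))
                         (λ w⊆w′ i → FaceSet⊆SymSet⇒⊑ w i (w′ i) (λ y c → w⊆w′ y c i))

  Meet : List (Fin k × Bool) → SubsetG G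
  Meet js y = All (λ j → Gen G B x j y) js

  symGens : Sym → Fin k → List (Fin k × Bool)
  symGens lo   i = (i , false) ∷ []
  symGens hi   i = (i , true) ∷ []
  symGens star i = []

  faceGens : (Fin k → Sym) → List (Fin k × Bool)
  faceGens w = concat (tabulate (λ i → symGens (w i) i))

  Meet-symGens : ∀ s i → _≐G_ G (Meet (symGens s i)) (SymSet s i)
  Meet-symGens lo   i = (λ { y (p ∷ []) → p }) , (λ y p → p ∷ [])
  Meet-symGens hi   i = (λ { y (p ∷ []) → p }) , (λ y p → p ∷ [])
  Meet-symGens star i = (λ y _ → lift tt) , (λ y _ → [])

  Meet-faceGens : ∀ w → _≐G_ G (Meet (faceGens w)) (FaceSet w)
  Meet-faceGens w =
    (λ y m i → proj₁ (Meet-symGens (w i) i) y (tabulate⁻ (concat⁻ m) i)) ,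
    (λ y c → concat⁺ (tabulate⁺ (λ i → proj₂ (Meet-symGens (w i) i) y (c i))))

  IsFaceOrEmpty : SubsetG G → Set _
  IsFaceOrEmpty S = (Σ (Fin k → Sym) λ w → _≐G_ G S (FaceSet w)) ⊎ (∀ y → ¬ S y)

  FaceSet-∩-Gen : ∀ w j → IsFaceOrEmpty (λ y → Gen G B x j y × FaceSet w y)
  FaceSet-∩-Gen w (i , b) with w i in e | b
  ... | star | false = inj₁ (updateAt w i (const lo) , ≐G-sym G (FaceSet-updateAt w i (inj₁ e)))
  ... | star | true  = inj₁ (updateAt w i (const hi) , ≐G-sym G (FaceSet-updateAt w i (inj₁ e)))
  ... | lo   | false = inj₁ (w , (λ y → proj₂) , λ y c → subst (λ u → SymSet u i y) e (c i) , c)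
  ... | hi   | true  = inj₁ (w , (λ y → proj₂) , λ y c → subst (λ u → SymSet u i y) e (c i) , c)
  ... | lo   | true  = inj₂ λ { y (p , c) → lo-hi-disjoint i y (subst (λ u → SymSet u i y) e (c i)) p }
  ... | hi   | false = inj₂ λ { y (p , c) → lo-hi-disjoint i y p (subst (λ u → SymSet u i y) e (c i)) }

  Meet-isFaceOrEmpty : ∀ js → IsFaceOrEmpty (Meet js)
  Meet-isFaceOrEmpty [] = inj₁ ((λ _ → star) , (λ y _ _ → lift tt) , (λ y _ → []))
  Meet-isFaceOrEmpty (j ∷ js) with Meet-isFaceOrEmpty js
  ... | inj₂ empty = inj₂ λ { y (_ ∷ m) → empty y m }
  ... | inj₁ (w , m⊆w , w⊆m) with FaceSet-∩-Gen w j
  ...   | inj₂ empty = inj₂ λ { y (p ∷ m) → empty y (p , m⊆w y m) }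
  ...   | inj₁ (w′ , ∩⊆w′ , w′⊆∩) =
    inj₁ (w′ , (λ { y (p ∷ m) → ∩⊆w′ y (p , m⊆w y m) }) ,
               λ y c → let (p , c′) = w′⊆∩ y c in p ∷ w⊆m y c′)

  ⊑ˢ-≢star : ∀ {s t} → s ⊑ˢ t → t ≢ star → s ≢ star
  ⊑ˢ-≢star (inj₁ t≡star) t≢star = ⊥-elim (t≢star t≡star)
  ⊑ˢ-≢star (inj₂ refl)   t≢star = t≢star

  FaceSet⊆Gen⇒≢star : ∀ w i b → _⊆G_ G (FaceSet w) (Gen G B x (i , b)) → w i ≢ star
  FaceSet⊆Gen⇒≢star w i false w⊆gen = ⊑ˢ-≢star (FaceSet⊆SymSet⇒⊑ w i lo w⊆gen) λ ()
  FaceSet⊆Gen⇒≢star w i true  w⊆gen = ⊑ˢ-≢star (FaceSet⊆SymSet⇒⊑ w i hi w⊆gen) λ ()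

  generatorContaining : ∀ s i → s ≢ star → Σ Bool λ b → _⊆G_ G (SymSet s i) (Gen G B x (i , b))
  generatorContaining lo   i _ = false , λ y p → p
  generatorContaining hi   i _ = true  , λ y p → p
  generatorContaining star i s≢star = ⊥-elim (s≢star refl)

  module _ (i₀ : Fin k) where
    faceMap : CubeBoundaryFace k → SubsetG G
    faceMap nothing        = InterGen G B x (i₀ , false) ((i₀ , true) ∷ [])
    faceMap (just (w , _)) = FaceSet w

    faceMap-nothing-empty : ∀ y → ¬ faceMap nothing y
    faceMap-nothing-empty y (p ∷ q ∷ []) = lo-hi-disjoint i₀ y p q

    faceMap-generated : ∀ F → InGenerated G B x (faceMap F)
    faceMap-generated nothing = (i₀ , false) , ((i₀ , true) ∷ []) , (λ y p → p) , (λ y p → p)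
    faceMap-generated (just (w , i , wᵢ≢star)) with generatorContaining (w i) i wᵢ≢star
    ... | b , wᵢ⊆gen = (i , b) , faceGens w ,
      (λ y c → wᵢ⊆gen y (c i) ∷ proj₂ (Meet-faceGens w) y c) ,
      (λ { y (_ ∷ m) → proj₁ (Meet-faceGens w) y m })

    generated⇒faceMap : ∀ S → InGenerated G B x S →
      Σ (CubeBoundaryFace k) λ F → _≐G_ G S (faceMap F)
    generated⇒faceMap S ((i , b) , js , S⊆m , m⊆S) with Meet-isFaceOrEmpty ((i , b) ∷ js)
    ... | inj₁ (w , m⊆w , w⊆m) =
      just (w , i , FaceSet⊆Gen⇒≢star w i b (λ y c → All.head (w⊆m y c))) ,
      (λ y s → m⊆w y (S⊆m y s)) , (λ y c → m⊆S y (w⊆m y c))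
    ... | inj₂ empty =
      nothing , (λ y s → ⊥-elim (empty y (S⊆m y s))) ,
                (λ y p → ⊥-elim (faceMap-nothing-empty y p))

    faceMap-order : ∀ F F′ → (F ≤F F′) ⇔ _⊆G_ G (faceMap F) (faceMap F′)
    faceMap-order nothing F′ = mk⇔ (λ _ y p → ⊥-elim (faceMap-nothing-empty y p)) (λ _ → tt)
    faceMap-order (just (w , _)) nothing = mk⇔ (λ ()) λ w⊆∅ →
      let (y , c) = FaceSet-nonempty w in faceMap-nothing-empty y (w⊆∅ y c)
    faceMap-order (just (w , _)) (just (w′ , _)) = FaceSet-⊆⇔⊑ w w′

corollary4p13 : {c ℓ : Level} (G : Group c ℓ) → IsFinite G → IsComplemented G →
    (k : ℕ) → k ≥ 1 →
    (N : Fin (suc k) → Subgroup G) → IsChiefSeries G k N →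
    (B : Fin k → Subgroup G) → IsBaseSet G k N B →
    (x : Group.Carrier G) →
    (∀ (i : Fin k) → ¬ (_≐G_ G (mem (B i)) (RightCoset G (B i) x))) →
    Σ (CubeBoundaryFace k → SubsetG G) λ φ →
      (∀ F → InGenerated G B x (φ F)) ×
      (∀ S → InGenerated G B x S → Σ (CubeBoundaryFace k) λ F → _≐G_ G S (φ F)) ×
      (∀ F F′ → (F ≤F F′) ⇔ _⊆G_ G (φ F) (φ F′))
corollary4p13 G _ _ (suc k) _ N (_ , _ , _ , N-descending , _) B base x B≢Bx =
  faceMap zero , faceMap-generated zero , generated⇒faceMap zero , faceMap-order zero
  where
    open Group G using (ε; _∙_)
    open Cosets G using (N₀-coset-meets-cosets; ∈⇒≐RightCoset)

    N⊆B : ∀ i → _⊆G_ G (mem (N (suc i))) (mem (B i))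
    N⊆B i y y∈N = proj₂ (proj₂ (proj₂ (base i)) y y∈N)

    cosets-meet : ∀ t → Σ (Group.Carrier G) λ g → ∀ i → RightCoset G (B i) (t i) g
    cosets-meet t with N₀-coset-meets-cosets N B N-descending N⊆B (λ i → proj₁ (base i)) ε t
    ... | n , _ , n∈cosets = n ∙ ε , n∈cosets

    open CubeFaces G B x cosets-meet (λ i x∈B → B≢Bx i (∈⇒≐RightCoset (B i) x∈B))
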